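{- Let $\mathcal{J}=\{1,\ldots,n\}$ be a set of jobs indexed so that $p_1\le\cdots\le p_n$, with tied jobs ordered by non-decreasing weight, let $i_1<\cdots<i_\ell$ be its key sequence, and let $u^*=\sum_{k=1}^{\ell}w_{i_k}(p_{i_k}-p_{i_{k-1}})$ with $p_{i_0}=0$. Let $\mathcal{S}_{\mathrm{opt}}=(\pi(1),\ldots,\pi(m))$ be an optimal synchronized schedule for $\mathcal{J}$, with completion times $C_{\pi(1)}<\cdots<C_{\pi(m)}$ of the jobs on the shared processor, and let $e^*=\sum_{j=1}^{m}w_{\pi(j)}(C_{\pi(j)}-C_{\pi(j-1)})$ with $C_{\pi(0)}=0$. Then $e^*\le u^*$.
   Context: Weighted Single-Processor Scheduling: job $j$ has processing time $p_j>0$ and weight $w_j\ge0$, its own private processor $\mathcal{P}_j$, and there is one shared processor $\mathcal{M}$. A feasible schedule: each job $j$ executes on $\mathcal{P}_j$ in a single interval $(0,C_j^{\mathcal{P}})$ and on $\mathcal{M}$ in a (possibly empty) collection $\mathcal{I}_j$ of open intervals, with $C_j^{\mathcal{P}}+\sum_{I\in\mathcal{I}_j}|I|=p_j$, and all intervals on $\mathcal{M}$ pairwise disjoint. The total overlap $t_j$ is the total time $j$ executes simultaneously on $\mathcal{P}_j$ and $\mathcal{M}$; the total weighted overlap is $\sum_j t_jw_j$, and a feasible schedule maximizing it is optimal. A schedule is synchronized if each job appearing on $\mathcal{M}$ executes there in a single interval, there is no idle time on $\mathcal{M}$ between $0$ and the last completion on $\mathcal{M}$, and each job appearing on $\mathcal{M}$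 completes at the same time on $\mathcal{M}$ and on its private processor; equivalently, for the order $(\pi(1),\ldots,\pi(m))$ of jobs on $\mathcal{M}$, job $\pi(i)$ runs on $\mathcal{M}$ in $(C_{\pi(i-1)},C_{\pi(i)})$ with $C_{\pi(i)}=(p_{\pi(i)}+C_{\pi(i-1)})/2$. (An optimal synchronized schedule always exists.) Key sequence: $1\le i_1<\cdots<i_\ell\le n$ with (i) $i_\ell=n$; (ii) $w_{i_1}>\cdots>w_{i_\ell}$; (iii) $w_k\le w_{i_j}$ for each $j\in\{1,\ldots,\ell\}$ and $k\in\{i_{j-1}+1,\ldots,i_j\}$, where $i_0=0$ (it exists and is unique).
   Formalization: The processing times $p_j$ and weights $w_j$ of the jobs take values in the rationals. -}

module Defs where

open import Data.Nat as ℕ using (ℕ; suc)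
open import Data.Fin using (Fin; toℕ)
open import Data.Rational using (ℚ; 0ℚ; ½; _+_; _*_; _-_; _≤_; _<_)
open import Data.List using (List; []; _∷_)
open import Data.List.Relation.Unary.Unique.Propositional using (Unique)
open import Data.Product using (_×_)
open import Data.Empty using (⊥)
open import Data.Unit using (⊤)
open import Relation.Binary.PropositionalEquality using (_≡_)

-- An instance: n jobs (indexed by Fin n, i.e. 0..n-1 instead of 1..n),
-- processing times p and weights w.
Times : ℕ → Set
Times n = Fin n → ℚ

ValidInstance : (n : ℕ) → Times n → Times n → Set
ValidInstance n p w = (∀ j → 0ℚ < p j) × (∀ j → 0ℚ ≤ w j)

SortedInstance : (n : ℕ) → Times n → Times n → Set
SortedInstance n p w =
  (∀ i j → toℕ i ℕ.< toℕ j → p i ≤ p j) ×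
  (∀ i j → toℕ i ℕ.< toℕ j → p i ≡ p j → w i ≤ w j)

-- Condition (iii) for one block: w_k ≤ w_i for every k with lo ≤ k ≤ i,
-- where lo = i_{j-1} + 1 (as a 0-based index; lo = 0 for the first block).
BlockMax : {n : ℕ} → Times n → ℕ → Fin n → Set
BlockMax w lo i = ∀ k → lo ℕ.≤ toℕ k → toℕ k ℕ.≤ toℕ i → w k ≤ w i

-- KeySeqFrom w lo (i_j ∷ ... ∷ i_ℓ): the remaining part of a key sequence,
-- lo being i_{j-1}+1. Encodes (i) last element is n (here index n-1),
-- strict increase, (ii) strictly decreasing weights, (iii) block maxima.
KeySeqFrom : {n : ℕ} → Times n → ℕ → List (Fin n) → Set
KeySeqFrom w lo [] = ⊥
KeySeqFrom {n} w lo (i ∷ []) = lo ℕ.≤ toℕ i × suc (toℕ i) ≡ n × BlockMax w lo i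
KeySeqFrom w lo (i ∷ i′ ∷ is) =
  lo ℕ.≤ toℕ i × BlockMax w lo i × w i′ < w i × KeySeqFrom w (suc (toℕ i)) (i′ ∷ is)

IsKeySequence : {n : ℕ} → Times n → List (Fin n) → Set
IsKeySequence w ks = KeySeqFrom w 0 ks

uStarFrom : {n : ℕ} → Times n → Times n → ℚ → List (Fin n) → ℚ
uStarFrom p w prev [] = 0ℚ
uStarFrom p w prev (i ∷ is) = w i * (p i - prev) + uStarFrom p w (p i) is

uStar : {n : ℕ} → Times n → Times n → List (Fin n) → ℚ
uStar p w ks = uStarFrom p w 0ℚ ks

-- Synchronized schedule given by the order π on the shared processor:
-- C_{π(i)} = (p_{π(i)} + C_{π(i-1)})/2, C_{π(0)} = 0.
-- Validity: each job appears at most once and C strictly increases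
-- (each job appearing on M executes there in a non-empty interval),
-- i.e. C_{π(i-1)} < p_{π(i)}.
ValidFrom : {n : ℕ} → Times n → ℚ → List (Fin n) → Set
ValidFrom p c [] = ⊤
ValidFrom p c (j ∷ js) = c < p j × ValidFrom p (½ * (p j + c)) js

IsSynchronized : {n : ℕ} → Times n → List (Fin n) → Set
IsSynchronized p π = Unique π × ValidFrom p 0ℚ π

-- e = Σ_j w_{π(j)} (C_{π(j)} - C_{π(j-1)}); for a synchronized schedule this
-- is exactly its total weighted overlap.
eFrom : {n : ℕ} → Times n → Times n → ℚ → List (Fin n) → ℚ
eFrom p w c [] = 0ℚ
eFrom p w c (j ∷ js) = w j * (½ * (p j + c) - c) + eFrom p w (½ * (p j + c)) js

weightedOverlap : {n : ℕ} → Times n → Times n → List (Fin n) → ℚ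
weightedOverlap p w π = eFrom p w 0ℚ π

IsOptimalSynchronized : {n : ℕ} → Times n → Times n → List (Fin n) → Set
IsOptimalSynchronized p w π =
  IsSynchronized p π × (∀ σ → IsSynchronized p σ → weightedOverlap p w σ ≤ weightedOverlap p w π)

{-# OPTIONS --safe #-}
module Submission where

open import Defs
open import Data.Nat using (ℕ)
open import Data.Fin using (Fin)
open import Data.List using (List)
open import Data.Rational using (_≤_)

open import Level using (0ℓ)
open import Data.Nat as ℕ using (suc; z≤n)
import Data.Nat.Properties as ℕ
open import Data.Fin using (toℕ)
open import Data.Fin.Properties using (toℕ<n; toℕ-injective)
open import Data.List using ([]; _∷_)
open import Data.Rational using (ℚ; 0ℚ; ½; _+_; _*_; _-_; -_; _<_; _≤?_; nonNegative)
open import Data.Rational.Properties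
  using (_≟_; ≤-refl; <⇒≤; ≤-<-trans; <-≤-trans; <-irrefl; ≰⇒>; +-mono-≤; +-monoˡ-≤; +-monoʳ-≤;
         +-monoˡ-<; +-monoʳ-<; +-inverseʳ; *-monoʳ-≤-nonNeg; *-monoʳ-<-pos;
         nonNegative⁻¹; nonNeg*nonNeg⇒nonNeg; +-*-commutativeRing; module ≤-Reasoning)
open import Data.Product using (_×_; _,_; proj₁)
open import Data.Sum using (inj₁; inj₂)
open import Data.Empty using (⊥; ⊥-elim)
open import Relation.Nullary using (yes; no)
open import Relation.Nullary.Decidable using (dec⇒maybe)
open import Relation.Binary.PropositionalEquality using (_≡_; refl; sym; subst)
open import Tactic.RingSolver using (solve-∀)
open import Tactic.RingSolver.Core.AlmostCommutativeRing using (AlmostCommutativeRing; fromCommutativeRing)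

-- u* is the area under the staircase W that equals w_{i_k} on (p_{i_{k-1}}, p_{i_k}].
-- By the defining properties of the key sequence, W(t) ≥ w_k whenever t < p_k.
-- In a synchronized schedule job π(j) runs on the shared processor during
-- (C_{π(j-1)}, C_{π(j)}) with C_{π(j)} < p_{π(j)}, so its contribution to e* is at most
-- the area under W over that interval; these intervals are disjoint, hence e* ≤ u*.

private
  ℚ-ring : AlmostCommutativeRing 0ℓ 0ℓ
  ℚ-ring = fromCommutativeRing +-*-commutativeRing (λ x → dec⇒maybe (0ℚ ≟ x))

p≤q⇒0≤q-p : ∀ {p q} → p ≤ q → 0ℚ ≤ q - p
p≤q⇒0≤q-p {p} {q} p≤q = subst (_≤ q - p) (+-inverseʳ p) (+-monoˡ-≤ (- p) p≤q)

*-nonNeg : ∀ {p q} → 0ℚ ≤ p → 0ℚ ≤ q → 0ℚ ≤ p * q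
*-nonNeg {p} {q} 0≤p 0≤q =
  nonNegative⁻¹ (p * q) {{nonNeg*nonNeg⇒nonNeg p {{nonNegative 0≤p}} q {{nonNegative 0≤q}}}}

*-monoʳ-≤-length : ∀ {x y a b} → x ≤ y → a ≤ b → x * (b - a) ≤ y * (b - a)
*-monoʳ-≤-length {a = a} {b} x≤y a≤b = *-monoʳ-≤-nonNeg (b - a) {{nonNegative (p≤q⇒0≤q-p a≤b)}} x≤y

*-length-split : ∀ x a b c u → x * (c - a) + u ≡ x * (b - a) + (x * (c - b) + u)
*-length-split = solve-∀ ℚ-ring

mean-self : ∀ a → ½ * (a + a) ≡ a
mean-self = solve-∀ ℚ-ring

mean-lower : ∀ {a b} → a < b → a < ½ * (b + a)
mean-lower {a} {b} a<b = subst (_< ½ * (b + a)) (mean-self a) (*-monoʳ-<-pos ½ (+-monoˡ-< a a<b))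

mean-upper : ∀ {a b} → a < b → ½ * (b + a) < b
mean-upper {a} {b} a<b = subst (½ * (b + a) <_) (mean-self b) (*-monoʳ-<-pos ½ (+-monoʳ-< b a<b))

last-index-max : ∀ {n} {i : Fin n} → suc (toℕ i) ≡ n → ∀ k → toℕ k ℕ.≤ toℕ i
last-index-max last k = ℕ.m<1+n⇒m≤n (subst (toℕ k ℕ.<_) (sym last) (toℕ<n k))

module _ {n : ℕ} (p w : Times n) where

  open ≤-Reasoning

  -- Staircase c (i₁ ∷ … ∷ iₗ): the step function that is w_{i_k} on (p_{i_{k-1}}, p_{i_k}],
  -- with p_{i_0} = c, dominates w_k on (c, p_k) for every job k; uStarFrom p w c is its area.
  mutual
    Staircase : ℚ → List (Fin n) → Set
    Staircase c [] = ⊥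
    Staircase c (i ∷ is) = c ≤ p i × (∀ k → c < p k → w k ≤ w i) × StaircaseAfter i is

    StaircaseAfter : Fin n → List (Fin n) → Set
    StaircaseAfter i [] = ∀ k → p k ≤ p i
    StaircaseAfter i (i′ ∷ is) = Staircase (p i) (i′ ∷ is)

  Staircase-raise : ∀ {c b i is} → c ≤ b → b ≤ p i → Staircase c (i ∷ is) → Staircase b (i ∷ is)
  Staircase-raise c≤b b≤pi (_ , dominates , after) =
    b≤pi , (λ k b<pk → dominates k (≤-<-trans c≤b b<pk)) , after

  module _ (w≥0 : ∀ k → 0ℚ ≤ w k) where

    mutual
      uStarFrom-nonNeg : ∀ c is → Staircase c is → 0ℚ ≤ uStarFrom p w c is
      uStarFrom-nonNeg c (i ∷ is) (c≤pi , _ , after) =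
        +-mono-≤ (*-nonNeg (w≥0 i) (p≤q⇒0≤q-p c≤pi)) (uStarFrom-nonNeg-after i is after)

      uStarFrom-nonNeg-after : ∀ i is → StaircaseAfter i is → 0ℚ ≤ uStarFrom p w (p i) is
      uStarFrom-nonNeg-after i [] _ = ≤-refl
      uStarFrom-nonNeg-after i (i′ ∷ is) st = uStarFrom-nonNeg (p i) (i′ ∷ is) st

    mutual
      eFrom≤uStarFrom : ∀ c π is → ValidFrom p c π → Staircase c is → eFrom p w c π ≤ uStarFrom p w c is
      eFrom≤uStarFrom c [] is _ st = uStarFrom-nonNeg c is st
      eFrom≤uStarFrom c (j ∷ js) is (c<pj , valid) st =
        segment≤uStarFrom c j (½ * (p j + c)) js is (<⇒≤ (mean-lower c<pj)) (mean-upper c<pj) valid st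

      segment≤uStarFrom : ∀ c j b js is → c ≤ b → b < p j → ValidFrom p b js → Staircase c is →
                          w j * (b - c) + eFrom p w b js ≤ uStarFrom p w c is
      segment≤uStarFrom c j b js (i ∷ is) c≤b b<pj valid st@(c≤pi , dominates , after)
        with b ≤? p i | dominates j (≤-<-trans c≤b b<pj)
      ... | yes b≤pi | wj≤wi = begin
        w j * (b - c) + eFrom p w b js
          ≤⟨ +-monoʳ-≤ (w j * (b - c))
                       (eFrom≤uStarFrom b js (i ∷ is) valid (Staircase-raise {is = is} c≤b b≤pi st)) ⟩
        w j * (b - c) + (w i * (p i - b) + uStarFrom p w (p i) is)
          ≤⟨ +-monoˡ-≤ (w i * (p i - b) + uStarFrom p w (p i) is) (*-monoʳ-≤-length wj≤wi c≤b) ⟩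
        w i * (b - c) + (w i * (p i - b) + uStarFrom p w (p i) is)
          ≡⟨ sym (*-length-split (w i) c b (p i) _) ⟩
        w i * (p i - c) + uStarFrom p w (p i) is ∎
      ... | no b≰pi | wj≤wi = begin
        w j * (b - c) + eFrom p w b js
          ≡⟨ *-length-split (w j) c (p i) b _ ⟩
        w j * (p i - c) + (w j * (b - p i) + eFrom p w b js)
          ≤⟨ +-mono-≤ (*-monoʳ-≤-length wj≤wi c≤pi)
                      (segment≤uStarFrom-after i j b js is (≰⇒> b≰pi) b<pj valid after) ⟩
        w i * (p i - c) + uStarFrom p w (p i) is ∎

      segment≤uStarFrom-after : ∀ i j b js is → p i < b → b < p j → ValidFrom p b js →
                                StaircaseAfter i is →
                                w j * (b - p i) + eFrom p w b js ≤ uStarFrom p w (p i) is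
      segment≤uStarFrom-after i j b js [] pi<b b<pj _ below =
        ⊥-elim (<-irrefl refl (<-≤-trans (<-≤-trans pi<b (<⇒≤ b<pj)) (below j)))
      segment≤uStarFrom-after i j b js (i′ ∷ is) pi<b b<pj valid st =
        segment≤uStarFrom (p i) j b js (i′ ∷ is) (<⇒≤ pi<b) b<pj valid st

module _ {n : ℕ} {p w : Times n} (sorted : SortedInstance n p w) where

  private
    p-sorted : ∀ {i j} → toℕ i ℕ.< toℕ j → p i ≤ p j
    p-sorted = sorted .proj₁ _ _

  p-mono-≤ : ∀ {i j} → toℕ i ℕ.≤ toℕ j → p i ≤ p j
  p-mono-≤ i≤j with ℕ.m≤n⇒m<n∨m≡n i≤j
  ... | inj₁ i<j = p-sorted i<j
  ... | inj₂ i≡j rewrite toℕ-injective i≡j = ≤-refl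

  p-<⇒index-< : ∀ {i j} → p i < p j → toℕ i ℕ.< toℕ j
  p-<⇒index-< {i} {j} pi<pj with toℕ i ℕ.<? toℕ j
  ... | yes i<j = i<j
  ... | no i≮j = ⊥-elim (<-irrefl refl (<-≤-trans pi<pj (p-mono-≤ (ℕ.≮⇒≥ i≮j))))

  keySeqFrom-lo≤head : ∀ {lo i is} → KeySeqFrom w lo (i ∷ is) → lo ℕ.≤ toℕ i
  keySeqFrom-lo≤head {is = []} (lo≤i , _) = lo≤i
  keySeqFrom-lo≤head {is = _ ∷ _} (lo≤i , _) = lo≤i

  keySeqFrom-head-max : ∀ {lo i} is → KeySeqFrom w lo (i ∷ is) → ∀ k → lo ℕ.≤ toℕ k → w k ≤ w i
  keySeqFrom-head-max [] (_ , last , blockMax) k lo≤k = blockMax k lo≤k (last-index-max last k)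
  keySeqFrom-head-max {i = i} (i′ ∷ is) (_ , blockMax , wi′<wi , key) k lo≤k with toℕ k ℕ.≤? toℕ i
  ... | yes k≤i = blockMax k lo≤k k≤i
  ... | no k≰i = <⇒≤ (≤-<-trans (keySeqFrom-head-max is key k (ℕ.≰⇒> k≰i)) wi′<wi)

  keySeqFrom⇒Staircase : ∀ {lo c i} is → KeySeqFrom w lo (i ∷ is) →
                         (∀ k → c < p k → lo ℕ.≤ toℕ k) → c ≤ p i → Staircase p w c (i ∷ is)
  keySeqFrom⇒Staircase {i = i} is key above c≤pi =
    c≤pi , (λ k c<pk → keySeqFrom-head-max is key k (above k c<pk)) , after is key
    where
    after : ∀ is → KeySeqFrom w _ (i ∷ is) → StaircaseAfter p w i is
    after [] (_ , last , _) k = p-mono-≤ (last-index-max last k)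
    after (i′ ∷ is) (_ , _ , _ , key′) =
      keySeqFrom⇒Staircase is key′ (λ k → p-<⇒index-< {i}) (p-sorted (keySeqFrom-lo≤head key′))

lemma3 : (n : ℕ) (p w : Times n) → ValidInstance n p w → SortedInstance n p w →
    (ks : List (Fin n)) → IsKeySequence w ks →
    (π : List (Fin n)) → IsOptimalSynchronized p w π →
    weightedOverlap p w π ≤ uStar p w ks
lemma3 n p w _ _ [] () π _
lemma3 n p w (p>0 , w≥0) sorted (i ∷ is) key π ((_ , valid) , _) =
  eFrom≤uStarFrom p w w≥0 0ℚ π (i ∷ is) valid
    (keySeqFrom⇒Staircase sorted is key (λ _ _ → z≤n) (<⇒≤ (p>0 i)))
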